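{- Let $\sigma\in\{132,213,312,3142\}$ and $n\geq 0$. Then the set of Fishburn permutations of length $n$ avoiding both $321$ and $\sigma$ equals the set of permutations of length $n$ avoiding the classical patterns $231$, $321$ and $\sigma$.
   Context: A permutation of length $n$ is a rearrangement $\pi=\pi_1\cdots\pi_n$ of $[n]$. A permutation $\pi$ contains a classical pattern $p\in S_k$ if some subsequence of $\pi$ of length $k$ is order-isomorphic to $p$; otherwise it avoids $p$. A Fishburn permutation is a permutation $\pi$ for which there are no indices $i<j$ with $\pi_j<\pi_i<\pi_{i+1}$ and $\pi_i=\pi_j+1$. -}

module Defs where

open import Data.Nat using (ℕ; zero; suc)
open import Data.Fin using (Fin; toℕ; zero; suc; _<_; inject₁)
open import Data.Product using (Σ; _×_; ∃-syntax)
open import Function.Definitions using (Injective)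
open import Function.Bundles using (_⇔_)
open import Relation.Binary.PropositionalEquality using (_≡_)
open import Relation.Nullary using (¬_)
open import Data.Unit using (⊤)

-- A permutation of length n: an injective (hence bijective) map
-- Fin n → Fin n; π i is the (0-based) value at (0-based) position i.
record Perm (n : ℕ) : Set where
  constructor perm
  field
    fun : Fin n → Fin n
    inj : Injective _≡_ _≡_ fun
open Perm public

Contains : ∀ {n k} → Perm n → Perm k → Set
Contains {n} {k} π p =
  Σ (Fin k → Fin n) λ f →
    (∀ (a b : Fin k) → a < b → f a < f b) ×
    (∀ (a b : Fin k) → (fun π (f a) < fun π (f b)) ⇔ (fun p a < fun p b))

Avoids : ∀ {n k} → Perm n → Perm k → Set
Avoids π p = ¬ Contains π p

-- Fishburn: no indices i < j with π_j < π_i < π_{i+1} and π_i = π_j + 1.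
-- Position i+1 of (0-based) i : Fin m is suc i, with i ranging over Fin m
-- embedded in Fin (suc m) via inject₁.
Fishburn : ∀ {n} → Perm n → Set
Fishburn {zero} π = ⊤
Fishburn {suc m} π =
  ∀ (i : Fin m) (j : Fin (suc m)) →
    ¬ ( (inject₁ i < j)
      × (fun π j < fun π (inject₁ i))
      × (fun π (inject₁ i) < fun π (suc i))
      × (toℕ (fun π (inject₁ i)) ≡ suc (toℕ (fun π j))) )


pat132-fun pat213-fun pat312-fun pat231-fun pat321-fun : Fin 3 → Fin 3
pat132-fun zero = zero
pat132-fun (suc zero) = suc (suc zero)
pat132-fun (suc (suc zero)) = suc zero
pat213-fun zero = suc zero
pat213-fun (suc zero) = zero
pat213-fun (suc (suc zero)) = suc (suc zero)
pat312-fun zero = suc (suc zero)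
pat312-fun (suc zero) = zero
pat312-fun (suc (suc zero)) = suc zero
pat231-fun zero = suc zero
pat231-fun (suc zero) = suc (suc zero)
pat231-fun (suc (suc zero)) = zero
pat321-fun zero = suc (suc zero)
pat321-fun (suc zero) = suc zero
pat321-fun (suc (suc zero)) = zero

pat3142-fun : Fin 4 → Fin 4
pat3142-fun zero = suc (suc zero)
pat3142-fun (suc zero) = zero
pat3142-fun (suc (suc zero)) = suc (suc (suc zero))
pat3142-fun (suc (suc (suc zero))) = suc zero

open import Relation.Binary.PropositionalEquality using (refl)

inj132 : Injective _≡_ _≡_ pat132-fun
inj132 {zero} {zero} _ = refl
inj132 {suc zero} {suc zero} _ = refl
inj132 {suc (suc zero)} {suc (suc zero)} _ = refl
inj132 {zero} {suc zero} ()
inj132 {zero} {suc (suc zero)} ()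
inj132 {suc zero} {zero} ()
inj132 {suc zero} {suc (suc zero)} ()
inj132 {suc (suc zero)} {zero} ()
inj132 {suc (suc zero)} {suc zero} ()

inj213 : Injective _≡_ _≡_ pat213-fun
inj213 {zero} {zero} _ = refl
inj213 {suc zero} {suc zero} _ = refl
inj213 {suc (suc zero)} {suc (suc zero)} _ = refl
inj213 {zero} {suc zero} ()
inj213 {zero} {suc (suc zero)} ()
inj213 {suc zero} {zero} ()
inj213 {suc zero} {suc (suc zero)} ()
inj213 {suc (suc zero)} {zero} ()
inj213 {suc (suc zero)} {suc zero} ()

inj312 : Injective _≡_ _≡_ pat312-fun
inj312 {zero} {zero} _ = refl
inj312 {suc zero} {suc zero} _ = refl
inj312 {suc (suc zero)} {suc (suc zero)} _ = refl
inj312 {zero} {suc zero} ()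
inj312 {zero} {suc (suc zero)} ()
inj312 {suc zero} {zero} ()
inj312 {suc zero} {suc (suc zero)} ()
inj312 {suc (suc zero)} {zero} ()
inj312 {suc (suc zero)} {suc zero} ()

inj231 : Injective _≡_ _≡_ pat231-fun
inj231 {zero} {zero} _ = refl
inj231 {suc zero} {suc zero} _ = refl
inj231 {suc (suc zero)} {suc (suc zero)} _ = refl
inj231 {zero} {suc zero} ()
inj231 {zero} {suc (suc zero)} ()
inj231 {suc zero} {zero} ()
inj231 {suc zero} {suc (suc zero)} ()
inj231 {suc (suc zero)} {zero} ()
inj231 {suc (suc zero)} {suc zero} ()

inj321 : Injective _≡_ _≡_ pat321-fun
inj321 {zero} {zero} _ = refl
inj321 {suc zero} {suc zero} _ = refl
inj321 {suc (suc zero)} {suc (suc zero)} _ = refl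
inj321 {zero} {suc zero} ()
inj321 {zero} {suc (suc zero)} ()
inj321 {suc zero} {zero} ()
inj321 {suc zero} {suc (suc zero)} ()
inj321 {suc (suc zero)} {zero} ()
inj321 {suc (suc zero)} {suc zero} ()

inj3142 : Injective _≡_ _≡_ pat3142-fun
inj3142 {a} {b} eq = go a b eq
  where
  go : ∀ a b → pat3142-fun a ≡ pat3142-fun b → a ≡ b
  go zero zero _ = refl
  go (suc zero) (suc zero) _ = refl
  go (suc (suc zero)) (suc (suc zero)) _ = refl
  go (suc (suc (suc zero))) (suc (suc (suc zero))) _ = refl
  go zero (suc zero) ()
  go zero (suc (suc zero)) ()
  go zero (suc (suc (suc zero))) ()
  go (suc zero) zero ()
  go (suc zero) (suc (suc zero)) ()
  go (suc zero) (suc (suc (suc zero))) ()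
  go (suc (suc zero)) zero ()
  go (suc (suc zero)) (suc zero) ()
  go (suc (suc zero)) (suc (suc (suc zero))) ()
  go (suc (suc (suc zero))) zero ()
  go (suc (suc (suc zero))) (suc zero) ()
  go (suc (suc (suc zero))) (suc (suc zero)) ()

p132 p213 p312 p231 p321 : Perm 3
p132 = perm pat132-fun inj132
p213 = perm pat213-fun inj213
p312 = perm pat312-fun inj312
p231 = perm pat231-fun inj231
p321 = perm pat321-fun inj321

p3142 : Perm 4
p3142 = perm pat3142-fun inj3142

data Sigma : Set where
  s132 s213 s312 s3142 : Sigma

σ-len : Sigma → ℕ
σ-len s3142 = 4
σ-len _ = 3

σ-pat : (s : Sigma) → Perm (σ-len s)
σ-pat s132 = p132
σ-pat s213 = p213
σ-pat s312 = p312
σ-pat s3142 = p3142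

-- Take a 231 at positions a < c < z. Walking right from a, the first ascent q, q+1 with
-- π q ≤ π a either has π q above π z, giving a 231 at (q, q+1, z) with adjacent first entries,
-- or below it, giving a 3142 at (a, q, c, z). For an adjacent 231 at (x, x+1, z), let w carry the
-- value π x − 1. If w lies right of x, then (x, w) is the pattern forbidden in Fishburn
-- permutations; if it lies left, (w, x+1, z) is a 231 with smaller first value, and we recurse.
-- So a Fishburn permutation containing 231 contains 3142, hence each of 132, 213, 312.
-- Conversely, a forbidden Fishburn pattern at i, j is a 231 at positions i, i+1, j.
module Submission where

open import Defs
open import Data.Nat using (ℕ)
open import Data.Product using (_×_)
open import Function.Bundles using (_⇔_)

import Data.Nat as ℕ
import Data.Nat.Properties as ℕ
open import Data.Nat using (zero; suc; s≤s; z≤n)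
open import Data.Fin using (Fin; zero; suc; toℕ; fromℕ<; inject₁; punchOut; _<_; _≤_; _>_)
open import Data.Fin.Properties
  using (toℕ-injective; toℕ-inject₁; toℕ-fromℕ<; toℕ<n; punchOut-injective; injective⇒≤; any?; all?; _≟_; _<?_;
         <-cmp; <-trans; <-irrefl; <-asym; ≤-refl; ≤-trans; <⇒≢; ≤∧≢⇒<)
open import Data.Fin.Induction using (<-wellFounded; >-wellFounded)
open import Induction.WellFounded using (Acc; acc)
open import Data.Product using (Σ; ∃; _,_; proj₁; proj₂)
open import Data.Sum using (_⊎_; inj₁; inj₂)
open import Data.Unit using (tt)
open import Function using (_∘_; id)
open import Function.Definitions using (Injective)
open import Function.Bundles using (mk⇔; Equivalence)
open import Function.Properties.Equivalence using () renaming (trans to ⇔-trans)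
open import Relation.Binary using (tri<; tri≈; tri>)
open import Relation.Binary.PropositionalEquality using (_≡_; _≢_; refl; sym; trans; cong; subst; subst₂)
open import Relation.Nullary using (¬_; yes; no; contradiction)
open import Relation.Nullary.Decidable using (True; toWitness)

_⋖_ : ∀ {n} → Fin n → Fin n → Set
x ⋖ y = toℕ y ≡ suc (toℕ x)

⋖⇒< : ∀ {n} {x y : Fin n} → x ⋖ y → x < y
⋖⇒< {y = y} x⋖y = subst (ℕ._≤ toℕ y) x⋖y ℕ.≤-refl

⋖-< : ∀ {n} {x y z : Fin n} → x ⋖ y → x < z → y ≤ z
⋖-< {z = z} x⋖y x<z = subst (ℕ._≤ toℕ z) (sym x⋖y) x<z

<-⋖ : ∀ {n} {x y z : Fin n} → x ⋖ y → z < y → z ≤ x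
<-⋖ x⋖y z<y = ℕ.s≤s⁻¹ (subst (_ ℕ.<_) x⋖y z<y)

<⇒∃⋖ : ∀ {n} {x y : Fin n} → x < y → ∃ (_⋖ y)
<⇒∃⋖ {y = suc y} _ = inject₁ y , cong suc (sym (toℕ-inject₁ y))

<⇒∃successor : ∀ {n} {x y : Fin n} → x < y → ∃ (x ⋖_)
<⇒∃successor {y = y} x<y = fromℕ< 1+x<n , toℕ-fromℕ< 1+x<n
  where
  1+x<n = ℕ.≤-<-trans x<y (toℕ<n y)

perm-surjective : ∀ {n} (π : Perm n) (v : Fin n) → ∃ λ x → fun π x ≡ v
perm-surjective {suc m} π v with any? (λ x → fun π x ≟ v)
... | yes found = found
... | no missed = contradiction (injective⇒≤ skip-v-injective) ℕ.1+n≰n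
  where
  v≢π : ∀ x → v ≢ fun π x
  v≢π x v≡πx = missed (x , sym v≡πx)
  skip-v : Fin (suc m) → Fin m
  skip-v x = punchOut (v≢π x)
  skip-v-injective : Injective _≡_ _≡_ skip-v
  skip-v-injective {x} {y} eq = inj π (punchOut-injective (v≢π x) (v≢π y) eq)

position : ∀ {n} → Perm n → Fin n → Fin n
position π v = proj₁ (perm-surjective π v)

fun-position : ∀ {n} (π : Perm n) v → fun π (position π v) ≡ v
fun-position π v = proj₂ (perm-surjective π v)

position-fun : ∀ {n} (π : Perm n) x → position π (fun π x) ≡ x
position-fun π x = inj π (fun-position π (fun π x))

increasing-by-steps : ∀ {k n} (g : Fin (suc k) → Fin n) → (∀ i → g (inject₁ i) < g (suc i)) →
                      ∀ a b → a < b → g a < g b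
increasing-by-steps {suc k} g step zero (suc zero) _ = step zero
increasing-by-steps {suc k} g step zero (suc (suc b)) _ =
  <-trans (step zero) (increasing-by-steps (g ∘ suc) (step ∘ suc) zero (suc b) (s≤s z≤n))
increasing-by-steps {suc k} g step (suc a) (suc b) (s≤s a<b) =
  increasing-by-steps (g ∘ suc) (step ∘ suc) a b a<b

contains-by-steps : ∀ {n k} (π : Perm n) (p : Perm (suc k)) (f : Fin (suc k) → Fin n) →
                    (∀ i → f (inject₁ i) < f (suc i)) →
                    (∀ i → fun π (f (position p (inject₁ i))) < fun π (f (position p (suc i)))) →
                    Contains π p
contains-by-steps π p f f-steps πf-steps =
  f , increasing-by-steps f f-steps , λ a b → mk⇔ (reflects a b) (preserves a b)
  where
  preserves : ∀ a b → fun p a < fun p b → fun π (f a) < fun π (f b)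
  preserves a b pa<pb =
    subst₂ (λ a′ b′ → fun π (f a′) < fun π (f b′)) (position-fun p a) (position-fun p b)
      (increasing-by-steps (fun π ∘ f ∘ position p) πf-steps (fun p a) (fun p b) pa<pb)
  reflects : ∀ a b → fun π (f a) < fun π (f b) → fun p a < fun p b
  reflects a b πfa<πfb with <-cmp (fun p a) (fun p b)
  ... | tri< pa<pb _ _ = pa<pb
  ... | tri≈ _ pa≡pb _ = contradiction πfa<πfb (<-irrefl (cong (fun π ∘ f) (inj p pa≡pb)))
  ... | tri> _ _ pb<pa = contradiction (preserves b a pb<pa) (<-asym πfa<πfb)

contains-trans : ∀ {n m k} (π : Perm n) (ρ : Perm m) (p : Perm k) →
                 Contains π ρ → Contains ρ p → Contains π p
contains-trans _ _ _ (f , f-increasing , f-iso) (g , g-increasing , g-iso) =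
  f ∘ g ,
  (λ a b a<b → f-increasing (g a) (g b) (g-increasing a b a<b)) ,
  (λ a b → ⇔-trans (f-iso (g a) (g b)) (g-iso a b))

contains-by-checked-steps : ∀ {n k} (π : Perm n) (p : Perm (suc k)) (f : Fin (suc k) → Fin n) →
  {True (all? λ i → f (inject₁ i) <? f (suc i))} →
  {True (all? λ i → fun π (f (position p (inject₁ i))) <? fun π (f (position p (suc i))))} →
  Contains π p
contains-by-checked-steps π p f {f-steps} {πf-steps} =
  contains-by-steps π p f (toWitness f-steps) (toWitness πf-steps)

p3142-contains-σ : ∀ s → Contains p3142 (σ-pat s)
p3142-contains-σ s132  = contains-by-checked-steps p3142 p132 suc
p3142-contains-σ s213  = contains-by-checked-steps p3142 p213 inject₁
p3142-contains-σ s312  = contains-by-checked-steps p3142 p312 λ where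
  zero             → zero
  (suc zero)       → suc zero
  (suc (suc zero)) → suc (suc (suc zero))
p3142-contains-σ s3142 = contains-by-checked-steps p3142 p3142 id

⋖⇒inject₁⋖suc : ∀ {m} {x x′ : Fin (suc m)} → x ⋖ x′ → ∃ λ i → inject₁ i ≡ x × suc i ≡ x′
⋖⇒inject₁⋖suc {x′ = suc i} x⋖x′ =
  i , toℕ-injective (trans (toℕ-inject₁ i) (ℕ.suc-injective x⋖x′)) , refl

inject₁⋖suc : ∀ {m} (i : Fin m) → inject₁ i ⋖ suc i
inject₁⋖suc i = cong suc (sym (toℕ-inject₁ i))

fishburn-pattern⇒¬Fishburn : ∀ {n} (π : Perm n) {x x′ j} → x ⋖ x′ → x < j →
  fun π j ⋖ fun π x → fun π x < fun π x′ → ¬ Fishburn π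
fishburn-pattern⇒¬Fishburn {suc m} π x⋖x′ x<j πj⋖πx πx<πx′ fishburn with ⋖⇒inject₁⋖suc x⋖x′
... | i , refl , refl = fishburn i _ (x<j , ⋖⇒< πj⋖πx , πx<πx′ , πj⋖πx)

module _ {n : ℕ} (π : Perm n) where

  record Ascent : Set where
    constructor ascent
    field
      bottom top : Fin n
      bottom⋖top : bottom ⋖ top
      rises : fun π bottom < fun π top

  record Adjacent231 : Set where
    constructor adjacent231
    field
      x x′ z : Fin n
      x⋖x′ : x ⋖ x′
      x′<z : x′ < z
      πz<πx : fun π z < fun π x
      πx<πx′ : fun π x < fun π x′

  231-at : ∀ {a b c} → a < b → b < c → fun π c < fun π a → fun π a < fun π b → Contains π p231
  231-at {a} {b} {c} a<b b<c πc<πa πa<πb = contains-by-steps π p231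
    (λ where zero → a ; (suc zero) → b ; (suc (suc zero)) → c)
    (λ where zero → a<b ; (suc zero) → b<c)
    (λ where zero → πc<πa ; (suc zero) → πa<πb)

  3142-at : ∀ {a b c d} → a < b → b < c → c < d →
            fun π b < fun π d → fun π d < fun π a → fun π a < fun π c → Contains π p3142
  3142-at {a} {b} {c} {d} a<b b<c c<d πb<πd πd<πa πa<πc = contains-by-steps π p3142
    (λ where zero → a ; (suc zero) → b ; (suc (suc zero)) → c ; (suc (suc (suc zero))) → d)
    (λ where zero → a<b ; (suc zero) → b<c ; (suc (suc zero)) → c<d)
    (λ where zero → πb<πd ; (suc zero) → πd<πa ; (suc (suc zero)) → πa<πc)

  ascent-between : ∀ {u v} → u < v → fun π u < fun π v →
    Σ Ascent λ A → u ≤ Ascent.bottom A × Ascent.bottom A < v × fun π (Ascent.bottom A) ≤ fun π u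
  ascent-between = go (>-wellFounded _)
    where
    go : ∀ {u v} → Acc _>_ u → u < v → fun π u < fun π v →
      Σ Ascent λ A → u ≤ Ascent.bottom A × Ascent.bottom A < v × fun π (Ascent.bottom A) ≤ fun π u
    go {u} {v} (acc later) u<v πu<πv with <⇒∃successor u<v
    ... | u′ , u⋖u′ with <-cmp (fun π u) (fun π u′)
    ... | tri< πu<πu′ _ _ = ascent u u′ u⋖u′ πu<πu′ , ≤-refl , u<v , ≤-refl
    ... | tri≈ _ πu≡πu′ _ = contradiction (inj π πu≡πu′) (<⇒≢ (⋖⇒< u⋖u′))
    ... | tri> _ _ πu′<πu =
      let u′<v = ≤∧≢⇒< (⋖-< u⋖u′ u<v) λ u′≡v →
                   <-asym πu′<πu (subst (λ w → fun π u < fun π w) (sym u′≡v) πu<πv)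
          (A , u′≤q , q<v , πq≤πu′) = go (later (⋖⇒< u⋖u′)) u′<v (<-trans πu′<πu πu<πv)
      in A , ≤-trans (ℕ.<⇒≤ (⋖⇒< u⋖u′)) u′≤q , q<v , ≤-trans πq≤πu′ (ℕ.<⇒≤ πu′<πu)

  231⇒3142⊎adjacent-231 : ∀ {a c z} → a < c → c < z → fun π z < fun π a → fun π a < fun π c →
    Contains π p3142 ⊎ Σ Adjacent231 λ o → fun π (Adjacent231.x o) ≤ fun π a
  231⇒3142⊎adjacent-231 {a} {c} {z} a<c c<z πz<πa πa<πc with ascent-between a<c πa<πc
  ... | ascent q q′ q⋖q′ πq<πq′ , a≤q , q<c , πq≤πa with <-cmp (fun π q) (fun π z)
  ... | tri< πq<πz _ _ =
    inj₁ (3142-at (≤∧≢⇒< a≤q λ { refl → <-asym πq<πz πz<πa }) q<c c<z πq<πz πz<πa πa<πc)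
  ... | tri≈ _ πq≡πz _ = contradiction (inj π πq≡πz) (<⇒≢ (<-trans q<c c<z))
  ... | tri> _ _ πz<πq =
    inj₂ (adjacent231 q q′ z q⋖q′ (ℕ.≤-<-trans (⋖-< q⋖q′ q<c) c<z) πz<πq πq<πq′ , πq≤πa)

  value-below : ∀ {y x} → fun π y < fun π x → ∃ λ w → fun π w ⋖ fun π x
  value-below πy<πx with <⇒∃⋖ πy<πx
  ... | v , v⋖πx = position π v , subst (_⋖ fun π _) (sym (fun-position π v)) v⋖πx

  Fishburn⇒adjacent-231⇒3142 : Fishburn π → Adjacent231 → Contains π p3142
  Fishburn⇒adjacent-231⇒3142 fishburn o = go o (<-wellFounded _)
    where
    go : (o : Adjacent231) → Acc _<_ (fun π (Adjacent231.x o)) → Contains π p3142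
    go (adjacent231 x x′ z x⋖x′ x′<z πz<πx πx<πx′) (acc smaller) with value-below πz<πx
    ... | w , πw⋖πx with <-cmp x w
    ... | tri< x<w _ _ = contradiction fishburn (fishburn-pattern⇒¬Fishburn π x⋖x′ x<w πw⋖πx πx<πx′)
    ... | tri≈ _ refl _ = contradiction refl (<⇒≢ (⋖⇒< πw⋖πx))
    ... | tri> _ _ w<x with 231⇒3142⊎adjacent-231 w<x′ x′<z πz<πw (<-trans (⋖⇒< πw⋖πx) πx<πx′)
      where
      w<x′ = <-trans w<x (⋖⇒< x⋖x′)
      πz<πw = ≤∧≢⇒< (<-⋖ πw⋖πx πz<πx) λ πz≡πw → <⇒≢ (<-trans w<x′ x′<z) (sym (inj π πz≡πw))
    ... | inj₁ has-3142 = has-3142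
    ... | inj₂ (o′ , πq≤πw) = go o′ (smaller (ℕ.≤-<-trans πq≤πw (⋖⇒< πw⋖πx)))

  Fishburn⇒231⇒3142 : Fishburn π → Contains π p231 → Contains π p3142
  Fishburn⇒231⇒3142 fishburn (f , increasing , iso)
    with 231⇒3142⊎adjacent-231 (increasing zero (suc zero) (s≤s z≤n))
                               (increasing (suc zero) (suc (suc zero)) (s≤s (s≤s z≤n)))
                               (Equivalence.from (iso (suc (suc zero)) zero) (s≤s z≤n))
                               (Equivalence.from (iso zero (suc zero)) (s≤s (s≤s z≤n)))
  ... | inj₁ has-3142 = has-3142
  ... | inj₂ (o , _) = Fishburn⇒adjacent-231⇒3142 fishburn o

avoids-231⇒Fishburn : ∀ {n} (π : Perm n) → Avoids π p231 → Fishburn π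
avoids-231⇒Fishburn {zero}  π _ = tt
avoids-231⇒Fishburn {suc m} π avoids-231 i j (i<j , πj<πi , πi<πi+1 , _) =
  avoids-231 (231-at π (⋖⇒< (inject₁⋖suc i)) i+1<j πj<πi πi<πi+1)
  where
  i+1<j : suc i < j
  i+1<j = ≤∧≢⇒< (⋖-< (inject₁⋖suc i) i<j) λ { refl → <-asym πj<πi πi<πi+1 }

Fishburn⇒avoids-σ⇒avoids-231 : ∀ s {n} (π : Perm n) → Fishburn π → Avoids π (σ-pat s) → Avoids π p231
Fishburn⇒avoids-σ⇒avoids-231 s π fishburn avoids-σ has-231 =
  avoids-σ (contains-trans π p3142 (σ-pat s) (Fishburn⇒231⇒3142 π fishburn has-231) (p3142-contains-σ s))

lemma1p2 : (s : Sigma) (n : ℕ) (π : Perm n) →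
    (Fishburn π × Avoids π p321 × Avoids π (σ-pat s))
      ⇔ (Avoids π p231 × Avoids π p321 × Avoids π (σ-pat s))
lemma1p2 s n π = mk⇔
  (λ (fishburn , avoids-321 , avoids-σ) →
     Fishburn⇒avoids-σ⇒avoids-231 s π fishburn avoids-σ , avoids-321 , avoids-σ)
  (λ (avoids-231 , avoids-321 , avoids-σ) → avoids-231⇒Fishburn π avoids-231 , avoids-321 , avoids-σ)
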